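{- Let $s,t,a$ be integers with $2\le a\le s\le t$ and $a(s+t-a-2)\ge 1$. Then for every positive integer $n$, $$r\!\left(K_{n,n},K_{s,t},\,st-a(s+t-a-2)+1\right)\ge \left(\frac{n}{t-1}\right)^{1/a}.$$
   Context: For graphs $G,H$ and an integer $q$ with $2\le q\le |E(H)|$, an $(H,q)$-coloring of $G$ is an edge-coloring of $G$ in which every subgraph of $G$ isomorphic to $H$ receives at least $q$ distinct colors; $r(G,H,q)$ is the minimum number of colors needed for $G$ to have an $(H,q)$-coloring. $K_{n,n}$, $K_{s,t}$ denote complete bipartite graphs. -}

module Defs where

open import Data.Nat using (ℕ; _*_; _+_; _∸_; _^_; _≤_)
open import Data.Fin using (Fin)
open import Data.Sum using (_⊎_; inj₁; inj₂)
open import Data.Unit using (⊤)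
open import Data.Empty using (⊥)
open import Data.Product using (Σ; ∃; _×_; _,_)
open import Relation.Binary.PropositionalEquality using (_≡_)
open import Function.Definitions using (Injective)

KV : ℕ → ℕ → Set
KV p r = Fin p ⊎ Fin r

KAdj : ∀ {p r} → KV p r → KV p r → Set
KAdj (inj₁ _) (inj₁ _) = ⊥
KAdj (inj₁ _) (inj₂ _) = ⊤
KAdj (inj₂ _) (inj₁ _) = ⊤
KAdj (inj₂ _) (inj₂ _) = ⊥

EdgeColouring : ℕ → ℕ → Set
EdgeColouring n k = Fin n → Fin n → Fin k

edgeColour : ∀ {n k} → EdgeColouring n k → (x y : KV n n) → KAdj x y → Fin k
edgeColour c (inj₁ i) (inj₂ j) _ = c i j
edgeColour c (inj₂ j) (inj₁ i) _ = c i j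

record Copy (s t n : ℕ) : Set where
  field
    φ      : KV s t → KV n n
    φ-inj  : Injective _≡_ _≡_ φ
    φ-adj  : ∀ u v → KAdj u v → KAdj (φ u) (φ v)

copyEdgeColour : ∀ {s t n k} → EdgeColouring n k → (C : Copy s t n) → Fin s → Fin t → Fin k
copyEdgeColour c C i j =
  edgeColour c (Copy.φ C (inj₁ i)) (Copy.φ C (inj₂ j)) (Copy.φ-adj C (inj₁ i) (inj₂ j) _)

AtLeastColours : ∀ {s t n k} → ℕ → EdgeColouring n k → Copy s t n → Set
AtLeastColours {s} {t} {n} {k} q c C =
  Σ (Fin q → Fin k) λ h → Injective _≡_ _≡_ h ×
    (∀ m → ∃ λ i → ∃ λ j → copyEdgeColour c C i j ≡ h m)

IsColouring : (s t q n k : ℕ) → EdgeColouring n k → Set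
IsColouring s t q n k c = (C : Copy s t n) → AtLeastColours q c C

-- r(K_{n,n}, K_{s,t}, q) ≥ (n/(t-1))^{1/a}, stated without reals:
-- every k admitting such a colouring satisfies n ≤ (t-1) * k^a.
-- (For t ≥ 2 and a ≥ 1 this is equivalent to k ≥ (n/(t-1))^{1/a}.)
RLowerBound : (s t q n a : ℕ) → Set
RLowerBound s t q n a =
  ∀ k (c : EdgeColouring n k) → IsColouring s t q n k c → n ≤ (t ∸ 1) * k ^ a

-- Suppose n > (t − 1)·k^a and fix a left vertices U. A right vertex sees U in one of k^a colour
-- patterns, so by pigeonhole some t right vertices T share a pattern: every u ∈ U is monochromatic
-- on T. Let V be the first a vertices of T. Among the remaining n − a left vertices, pigeonhole on
-- the colour patterns towards V gives s − a vertices W on which every v ∈ V is monochromatic.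
-- The copy of K_{s,t} on (U ∪ W) × T then uses at most a + a + (s − a)(t − a) = st − a(s + t − a − 2)
-- colours, one fewer than a (K_{s,t}, q)-colouring requires.
module Submission where

open import Defs
open import Data.Nat using (ℕ; zero; suc; _*_; _+_; _∸_; _≤_; _<_; _^_; z≤n; _≤?_; _<?_)
open import Data.Nat.Properties
open import Data.Nat.Solver using (module +-*-Solver)
open import Data.Fin as Fin using (Fin)
open import Data.Fin.Properties using (injective⇒≤; nonZeroIndex) renaming (_≟_ to _≟ᶠ_)
open import Data.List using (List; []; _∷_; _++_; length; map; take; drop; filter; allFin; lookup; cartesianProductWith)
open import Data.List.Properties using (length-map; length-++; length-take; length-drop; length-tabulate; take++drop≡id)
open import Data.List.Relation.Unary.All as All using (All; []; _∷_)
open import Data.List.Relation.Unary.All.Properties using (all-filter) renaming (filter⁺ to All-filter⁺)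
open import Data.List.Relation.Unary.Any as Any using (here; there)
open import Data.List.Relation.Unary.AllPairs using ([]; _∷_)
open import Data.List.Relation.Unary.Unique.Propositional using (Unique)
open import Data.List.Relation.Unary.Unique.Propositional.Properties using (allFin⁺)
open import Data.List.Membership.Propositional using (_∈_)
open import Data.List.Membership.Propositional.Properties
  using (∈-map⁺; ∈-++⁺ˡ; ∈-++⁺ʳ; ∈-++⁻; ∈-allFin; ∈-lookup; ∈-cartesianProductWith⁺)
open import Data.List.Membership.Setoid.Properties using (index-injective)
open import Data.List.Relation.Binary.Sublist.Propositional using (_⊆_; _⊇_; []; _∷_; _∷ʳ_; ⊆-refl; ⊆-trans; minimum)
open import Data.List.Relation.Binary.Sublist.Propositional.Properties
  using (All-resp-⊆; Any-resp-⊆; take-⊆; filter-⊆; ++⁺)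
open import Data.Product using (Σ; ∃; ∃₂; _×_; _,_)
open import Data.Sum using (inj₁; inj₂)
open import Data.Sum.Properties using (inj₁-injective; inj₂-injective)
open import Data.Unit using (tt)
open import Function using (flip)
open import Function.Definitions using (Injective)
open import Level using (Level)
open import Relation.Binary using (DecidableEquality; _Respects_)
open import Relation.Binary.PropositionalEquality
open import Relation.Nullary using (yes; no; contradiction)
open import Relation.Unary using (Pred; Decidable)
open import Relation.Unary.Properties using (∁?)

private variable
  ℓ : Level
  A B C : Set

length-filter+length-filter-∁ : {P : Pred A ℓ} (P? : Decidable P) (xs : List A) →
  length (filter P? xs) + length (filter (∁? P?) xs) ≡ length xs
length-filter+length-filter-∁ P? [] = refl
length-filter+length-filter-∁ P? (x ∷ xs) with P? x
... | yes _ = cong suc (length-filter+length-filter-∁ P? xs)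
... | no  _ = trans (+-suc _ _) (cong suc (length-filter+length-filter-∁ P? xs))

length-take-≤ : ∀ {m} (xs : List A) → m ≤ length xs → length (take m xs) ≡ m
length-take-≤ {m = m} xs m≤|xs| = trans (length-take m xs) (m≤n⇒m⊓n≡m m≤|xs|)

length-cartesianProductWith : (f : A → B → C) (xs : List A) (ys : List B) →
  length (cartesianProductWith f xs ys) ≡ length xs * length ys
length-cartesianProductWith f []       ys = refl
length-cartesianProductWith f (x ∷ xs) ys = begin
  length (map (f x) ys ++ cartesianProductWith f xs ys)        ≡⟨ length-++ (map (f x) ys) ⟩
  length (map (f x) ys) + length (cartesianProductWith f xs ys)
    ≡⟨ cong₂ _+_ (length-map (f x) ys) (length-cartesianProductWith f xs ys) ⟩
  length ys + length xs * length ys                              ∎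
  where open ≡-Reasoning

Unique-resp-⊆ : Unique {A = A} Respects _⊇_
Unique-resp-⊆ []         []         = []
Unique-resp-⊆ (_ ∷ʳ xs⊆ys) (_ ∷ uys) = Unique-resp-⊆ xs⊆ys uys
Unique-resp-⊆ (refl ∷ xs⊆ys) (y∉ys ∷ uys) = All-resp-⊆ xs⊆ys y∉ys ∷ Unique-resp-⊆ xs⊆ys uys

lookup-injective : {xs : List A} → Unique xs → Injective _≡_ _≡_ (lookup xs)
lookup-injective (_ ∷ _)       {Fin.zero}  {Fin.zero}  _  = refl
lookup-injective (x∉xs ∷ _)    {Fin.zero}  {Fin.suc j} eq = contradiction eq (All.lookup x∉xs (∈-lookup j))
lookup-injective (x∉xs ∷ _)    {Fin.suc i} {Fin.zero}  eq = contradiction (sym eq) (All.lookup x∉xs (∈-lookup i))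
lookup-injective (_ ∷ uxs)     {Fin.suc i} {Fin.suc j} eq = cong Fin.suc (lookup-injective uxs eq)

module _ (_≟_ : DecidableEquality B) (f : A → B) where

  pigeonhole : ∀ r (cs : List B) (xs : List A) → All (λ x → f x ∈ cs) xs → r * length cs < length xs →
    ∃₂ λ b ys → ys ⊆ xs × r < length ys × All (λ y → f y ≡ b) ys
  pigeonhole r []       []      _          r*0<0 = contradiction (subst (_< 0) (*-zeroʳ r) r*0<0) n≮0
  pigeonhole r []       (_ ∷ _) (() ∷ _)   _
  pigeonhole r (b ∷ cs) xs      xs⊆cs      big with r <? length (filter (λ x → f x ≟ b) xs)
  ... | yes bigFibre = b , _ , filter-⊆ _ xs , bigFibre , all-filter _ xs
  ... | no smallFibre with pigeonhole r cs rest rest⊆cs bigRest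
    where
    P? = λ x → f x ≟ b
    rest = filter (∁? P?) xs
    rest⊆cs : All (λ x → f x ∈ cs) rest
    rest⊆cs = All.zipWith (λ { (here fx≡b , fx≢b) → contradiction fx≡b fx≢b ; (there fx∈cs , _) → fx∈cs })
                          (All-filter⁺ (∁? P?) xs⊆cs , all-filter (∁? P?) xs)
    bigRest : r * length cs < length rest
    bigRest = +-cancelˡ-< r _ _ (begin-strict
      r + r * length cs                              ≡⟨ *-suc r (length cs) ⟨
      r * suc (length cs)                            <⟨ big ⟩
      length xs                                      ≡⟨ length-filter+length-filter-∁ P? xs ⟨
      length (filter P? xs) + length rest            ≤⟨ +-monoˡ-≤ _ (≮⇒≥ smallFibre) ⟩
      r + length rest                                ∎)
      where open ≤-Reasoning
  ... | b′ , ys , ys⊆rest , big′ , ys≡b′ = b′ , ys , ⊆-trans ys⊆rest (filter-⊆ _ xs) , big′ , ys≡b′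

MonoStars : (A → B → C) → List A → List B → Set
MonoStars c us ys = ∀ {u y y′} → u ∈ us → y ∈ ys → y′ ∈ ys → c u y ≡ c u y′

MonoStars-resp-⊆ : {c : A → B → C} {us : List A} → (MonoStars c us) Respects _⊇_
MonoStars-resp-⊆ ys⊆zs mono u∈us y∈ys y′∈ys = mono u∈us (Any-resp-⊆ ys⊆zs y∈ys) (Any-resp-⊆ ys⊆zs y′∈ys)

monoStars-palette : {c : A → B → C} {us : List A} {ys : List B} → MonoStars c us ys →
  ∃ λ cs → length cs ≤ length us × (∀ {u y} → u ∈ us → y ∈ ys → c u y ∈ cs)
monoStars-palette {ys = []} _ = [] , z≤n , λ _ ()
monoStars-palette {c = c} {us} {y₀ ∷ _} mono =
  map (λ u → c u y₀) us , ≤-reflexive (length-map _ us) ,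
  λ u∈us y∈ys → subst (_∈ map (λ u → c u y₀) us) (mono u∈us (here refl) y∈ys) (∈-map⁺ (λ u → c u y₀) u∈us)

module _ {k : ℕ} (c : A → B → Fin k) where

  monoStars-sublist : ∀ (us : List A) r (xs : List B) → r * k ^ length us < length xs →
    ∃ λ ys → ys ⊆ xs × r < length ys × MonoStars c us ys
  monoStars-sublist [] r xs big = xs , ⊆-refl , subst (_< length xs) (*-identityʳ r) big , λ ()
  monoStars-sublist (u ∷ us) r xs big
    with pigeonhole _≟ᶠ_ (c u) (r * k ^ length us) (allFin k) xs (All.tabulate λ _ → ∈-allFin _) bigFor-u
    where
    bigFor-u : r * k ^ length us * length (allFin k) < length xs
    bigFor-u = subst (_< length xs) (begin
      r * (k * k ^ length us)             ≡⟨ cong (r *_) (*-comm k _) ⟩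
      r * (k ^ length us * k)             ≡⟨ *-assoc r _ k ⟨
      r * k ^ length us * k               ≡⟨ cong (r * k ^ length us *_) (length-tabulate {n = k} (λ i → i)) ⟨
      r * k ^ length us * length (allFin k) ∎) big
      where open ≡-Reasoning
  ... | _ , zs , zs⊆xs , bigZs , zs≡b with monoStars-sublist us r zs bigZs
  ... | ys , ys⊆zs , bigYs , mono = ys , ⊆-trans ys⊆zs zs⊆xs , bigYs , mono′
    where
    mono′ : MonoStars c (u ∷ us) ys
    mono′ (here refl) y∈ys y′∈ys =
      trans (All.lookup zs≡b (Any-resp-⊆ ys⊆zs y∈ys)) (sym (All.lookup zs≡b (Any-resp-⊆ ys⊆zs y′∈ys)))
    mono′ (there u∈us) = mono u∈us

  -- The bound is (m − 1)·K < |xs| without truncated subtraction, which would wrongly demand |xs| > 0 for m = 0.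
  monoStars-ofLength : ∀ (us : List A) m (xs : List B) → m * k ^ length us < length xs + k ^ length us →
    ∃ λ ys → ys ⊆ xs × length ys ≡ m × MonoStars c us ys
  monoStars-ofLength us zero    xs _   = [] , minimum xs , refl , λ _ ()
  monoStars-ofLength us (suc r) xs big
    with monoStars-sublist us r xs (+-cancelˡ-< K _ _ (subst (K + r * K <_) (+-comm _ K) big))
    where K = k ^ length us
  ... | ys , ys⊆xs , r<|ys| , mono =
    take (suc r) ys , ⊆-trans (take-⊆ _ ys) ys⊆xs , length-take-≤ ys r<|ys| ,
    MonoStars-resp-⊆ (take-⊆ _ ys) mono

blockPalette : (c : A → B → C) (a : ℕ) (U W : List A) (T : List B) →
  MonoStars c U T → MonoStars (flip c) (take a T) W →
  ∃ λ cs → length cs ≤ length U + length (take a T) + length W * length (drop a T) ×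
           (∀ {x y} → x ∈ U ++ W → y ∈ T → c x y ∈ cs)
blockPalette c a U W T monoU monoW with monoStars-palette monoU | monoStars-palette monoW
... | csU , |csU|≤ , csU-colours | csW , |csW|≤ , csW-colours =
  csU ++ csW ++ cartesianProductWith c W (drop a T) , |cs|≤ , colours
  where
  |cs|≤ : length (csU ++ csW ++ cartesianProductWith c W (drop a T)) ≤ _
  |cs|≤ = begin
    length (csU ++ csW ++ cartesianProductWith c W (drop a T))
      ≡⟨ length-++ csU ⟩
    length csU + length (csW ++ cartesianProductWith c W (drop a T))
      ≡⟨ cong (length csU +_) (trans (length-++ csW) (cong (length csW +_) (length-cartesianProductWith c W (drop a T)))) ⟩
    length csU + (length csW + length W * length (drop a T))
      ≤⟨ +-mono-≤ |csU|≤ (+-monoˡ-≤ _ |csW|≤) ⟩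
    length U + (length (take a T) + length W * length (drop a T))
      ≡⟨ +-assoc (length U) _ _ ⟨
    length U + length (take a T) + length W * length (drop a T) ∎
    where open ≤-Reasoning
  colours : ∀ {x y} → x ∈ U ++ W → y ∈ T → c x y ∈ _
  colours {x} {y} x∈U++W y∈T with ∈-++⁻ U x∈U++W
  ... | inj₁ x∈U = ∈-++⁺ˡ (csU-colours x∈U y∈T)
  ... | inj₂ x∈W with ∈-++⁻ (take a T) (subst (y ∈_) (sym (take++drop≡id a T)) y∈T)
  ...   | inj₁ y∈V  = ∈-++⁺ʳ csU (∈-++⁺ˡ (csW-colours y∈V x∈W))
  ...   | inj₂ y∈V′ = ∈-++⁺ʳ csU (∈-++⁺ʳ csW (∈-cartesianProductWith⁺ c x∈W y∈V′))

CopyWithPalette : (s t : ℕ) {n k : ℕ} → EdgeColouring n k → ℕ → Set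
CopyWithPalette s t {n} {k} c b =
  Σ (Copy s t n) λ C → ∃ λ (cs : List (Fin k)) → length cs ≤ b × (∀ i j → copyEdgeColour c C i j ∈ cs)

module _ {n : ℕ} where

  copyOn : (ls rs : List (Fin n)) → Unique ls → Unique rs → Copy (length ls) (length rs) n
  copyOn ls rs uls urs = record { φ = φ ; φ-inj = φ-inj ; φ-adj = φ-adj }
    where
    φ : KV (length ls) (length rs) → KV n n
    φ (inj₁ i) = inj₁ (lookup ls i)
    φ (inj₂ j) = inj₂ (lookup rs j)
    φ-inj : Injective _≡_ _≡_ φ
    φ-inj {inj₁ _} {inj₁ _} eq = cong inj₁ (lookup-injective uls (inj₁-injective eq))
    φ-inj {inj₂ _} {inj₂ _} eq = cong inj₂ (lookup-injective urs (inj₂-injective eq))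
    φ-adj : ∀ u v → KAdj u v → KAdj (φ u) (φ v)
    φ-adj (inj₁ _) (inj₂ _) _ = tt
    φ-adj (inj₂ _) (inj₁ _) _ = tt

  copyWithPalette : ∀ {s t k b} (c : EdgeColouring n k) {ls rs : List (Fin n)} →
    Unique ls → Unique rs → length ls ≡ s → length rs ≡ t →
    (cs : List (Fin k)) → length cs ≤ b → (∀ {x y} → x ∈ ls → y ∈ rs → c x y ∈ cs) → CopyWithPalette s t c b
  copyWithPalette c {ls} {rs} uls urs refl refl cs |cs|≤b colours =
    copyOn ls rs uls urs , cs , |cs|≤b , λ i j → colours (∈-lookup i) (∈-lookup j)

atLeastColours⇒≤length : ∀ {s t n k q} {c : EdgeColouring n k} {C : Copy s t n} {cs : List (Fin k)} →
  AtLeastColours q c C → (∀ i j → copyEdgeColour c C i j ∈ cs) → q ≤ length cs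
atLeastColours⇒≤length {cs = cs} (h , h-inj , h-onCopy) colours = injective⇒≤ index-inj
  where
  h∈cs : ∀ m → h m ∈ cs
  h∈cs m with i , j , eq ← h-onCopy m = subst (_∈ cs) eq (colours i j)
  index-inj : Injective _≡_ _≡_ (λ m → Any.index (h∈cs m))
  index-inj {m} {m′} eq = h-inj (index-injective (setoid (Fin _)) (h∈cs m) (h∈cs m′) eq)

[s∸a]*K<n∸a+K : ∀ {K a s t n} → 1 ≤ K → a ≤ s → s ≤ t → a ≤ n → (t ∸ 1) * K < n → (s ∸ a) * K < n ∸ a + K
[s∸a]*K<n∸a+K {K} {a} {s} {t} {n} 1≤K a≤s s≤t a≤n big = +-cancelʳ-< a _ _ (begin-strict
  (s ∸ a) * K + a      ≤⟨ +-monoʳ-≤ _ (subst (_≤ a * K) (*-identityʳ a) (*-monoʳ-≤ a 1≤K)) ⟩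
  (s ∸ a) * K + a * K  ≡⟨ *-distribʳ-+ K (s ∸ a) a ⟨
  (s ∸ a + a) * K      ≡⟨ cong (_* K) (m∸n+n≡m a≤s) ⟩
  s * K                ≤⟨ *-monoˡ-≤ K (≤-trans s≤t (m≤n+m∸n t 1)) ⟩
  K + (t ∸ 1) * K      <⟨ +-monoʳ-< K big ⟩
  K + n                ≡⟨ cong (K +_) (m∸n+n≡m a≤n) ⟨
  K + (n ∸ a + a)      ≡⟨ +-assoc K _ a ⟨
  K + (n ∸ a) + a      ≡⟨ cong (_+ a) (+-comm K (n ∸ a)) ⟩
  n ∸ a + K + a        ∎)
  where open ≤-Reasoning

s*t∸a*[s+t∸a∸2]≡a+a+[s∸a]*[t∸a] : ∀ {s t a} → 2 ≤ a → a ≤ s → a ≤ t →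
  s * t ∸ a * (s + t ∸ a ∸ 2) ≡ a + a + (s ∸ a) * (t ∸ a)
s*t∸a*[s+t∸a∸2]≡a+a+[s∸a]*[t∸a] {s} {t} {a} 2≤a a≤s a≤t
  with a ∸ 2 | m+[n∸m]≡n 2≤a | s ∸ a | m+[n∸m]≡n a≤s | t ∸ a | m+[n∸m]≡n a≤t
... | b | refl | x | refl | y | refl = begin
  (2 + b + x) * (2 + b + y) ∸ (2 + b) * ((2 + b + x) + (2 + b + y) ∸ (2 + b) ∸ 2)
    ≡⟨ cong (λ m → (2 + b + x) * (2 + b + y) ∸ (2 + b) * (m ∸ (2 + b) ∸ 2)) sum-split ⟩
  (2 + b + x) * (2 + b + y) ∸ (2 + b) * ((2 + b) + (2 + (x + b + y)) ∸ (2 + b) ∸ 2)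
    ≡⟨ cong (λ m → (2 + b + x) * (2 + b + y) ∸ (2 + b) * (m ∸ 2)) (m+n∸m≡n (2 + b) _) ⟩
  (2 + b + x) * (2 + b + y) ∸ (2 + b) * (x + b + y)
    ≡⟨ cong (_∸ (2 + b) * (x + b + y)) product-split ⟩
  (2 + b) * (x + b + y) + ((2 + b) + (2 + b) + x * y) ∸ (2 + b) * (x + b + y)
    ≡⟨ m+n∸m≡n ((2 + b) * (x + b + y)) _ ⟩
  (2 + b) + (2 + b) + x * y ∎
  where
  open ≡-Reasoning
  open +-*-Solver
  sum-split : (2 + b + x) + (2 + b + y) ≡ (2 + b) + (2 + (x + b + y))
  sum-split = solve 3 (λ b x y → (con 2 :+ b :+ x) :+ (con 2 :+ b :+ y) := (con 2 :+ b) :+ (con 2 :+ (x :+ b :+ y))) refl b x y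
  product-split : (2 + b + x) * (2 + b + y) ≡ (2 + b) * (x + b + y) + ((2 + b) + (2 + b) + x * y)
  product-split = solve 3 (λ b x y → (con 2 :+ b :+ x) :* (con 2 :+ b :+ y)
                                     := (con 2 :+ b) :* (x :+ b :+ y) :+ ((con 2 :+ b) :+ (con 2 :+ b) :+ x :* y)) refl b x y

fewColouredCopy : ∀ {s t a n k} → a ≤ s → s ≤ t → (c : EdgeColouring n k) → (t ∸ 1) * k ^ a < n →
  CopyWithPalette s t c (a + a + (s ∸ a) * (t ∸ a))
fewColouredCopy {s} {t} {a} {n} {k} a≤s s≤t c big = withRightSide (monoStars-ofLength c U t Vs bound₁)
  where
  Vs = allFin n
  U  = take a Vs
  R  = drop a Vs
  K  = k ^ a
  some-vertex : Fin n
  some-vertex = Fin.fromℕ< (≤-<-trans z≤n big)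
  1≤K : 1 ≤ K
  1≤K = m^n>0 k {{nonZeroIndex (c some-vertex some-vertex)}} a
  t≤n : t ≤ n
  t≤n = ≤-trans (m≤n+m∸n t 1) (≤-<-trans (subst (_≤ (t ∸ 1) * K) (*-identityʳ _) (*-monoʳ-≤ (t ∸ 1) 1≤K)) big)
  |Vs|≡n : length Vs ≡ n
  |Vs|≡n = length-tabulate {n = n} (λ i → i)
  |U|≡a : length U ≡ a
  |U|≡a = length-take-≤ Vs (subst (a ≤_) (sym |Vs|≡n) (≤-trans a≤s (≤-trans s≤t t≤n)))
  bound₁ : t * k ^ length U < length Vs + k ^ length U
  bound₁ = subst₂ (λ l m → t * k ^ l < m + k ^ l) (sym |U|≡a) (sym |Vs|≡n) ([s∸a]*K<n∸a+K {s = t} {t = t} 1≤K z≤n ≤-refl z≤n big)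

  withRightSide : (∃ λ T → T ⊆ Vs × length T ≡ t × MonoStars c U T) → CopyWithPalette s t c _
  withRightSide (T , T⊆Vs , |T|≡t , monoT) = withLeftSide (monoStars-ofLength (flip c) V (s ∸ a) R bound₂)
    where
    V = take a T
    |V|≡a : length V ≡ a
    |V|≡a = length-take-≤ T (subst (a ≤_) (sym |T|≡t) (≤-trans a≤s s≤t))
    bound₂ : (s ∸ a) * k ^ length V < length R + k ^ length V
    bound₂ = subst₂ (λ l m → (s ∸ a) * k ^ l < m + k ^ l) (sym |V|≡a) (sym (trans (length-drop a Vs) (cong (_∸ a) |Vs|≡n)))
               ([s∸a]*K<n∸a+K 1≤K a≤s s≤t (≤-trans a≤s (≤-trans s≤t t≤n)) big)

    withLeftSide : (∃ λ W → W ⊆ R × length W ≡ s ∸ a × MonoStars (flip c) V W) → CopyWithPalette s t c _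
    withLeftSide (W , W⊆R , |W|≡s∸a , monoW) with blockPalette c a U W T monoT monoW
    ... | cs , |cs|≤ , colours = copyWithPalette c uUW uT |UW|≡s |T|≡t cs (≤-trans |cs|≤ (≤-reflexive sizes)) colours
      where
      uT : Unique T
      uT = Unique-resp-⊆ T⊆Vs (allFin⁺ n)
      uUW : Unique (U ++ W)
      uUW = Unique-resp-⊆ (subst (U ++ W ⊆_) (take++drop≡id a Vs) (++⁺ ⊆-refl W⊆R)) (allFin⁺ n)
      |UW|≡s : length (U ++ W) ≡ s
      |UW|≡s = trans (length-++ U) (trans (cong₂ _+_ |U|≡a |W|≡s∸a) (m+[n∸m]≡n a≤s))
      sizes : length U + length V + length W * length (drop a T) ≡ a + a + (s ∸ a) * (t ∸ a)
      sizes = cong₂ _+_ (cong₂ _+_ |U|≡a |V|≡a) (cong₂ _*_ |W|≡s∸a (trans (length-drop a T) (cong (_∸ a) |T|≡t)))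

theorem7p2 : (s t a : ℕ) → 2 ≤ a → a ≤ s → s ≤ t → 1 ≤ a * (s + t ∸ a ∸ 2) →
    (n : ℕ) → 1 ≤ n →
    RLowerBound s t (s * t ∸ a * (s + t ∸ a ∸ 2) + 1) n a
theorem7p2 s t a 2≤a a≤s s≤t _ n _ k c isColouring with n ≤? (t ∸ 1) * k ^ a
... | yes n≤ = n≤
... | no n≰ with fewColouredCopy a≤s s≤t c (≰⇒> n≰)
... | C , cs , |cs|≤q-1 , colours = contradiction (≤-trans q≤|cs| |cs|≤q-1) (m+1+n≰m _)
  where
  q≤|cs| : a + a + (s ∸ a) * (t ∸ a) + 1 ≤ length cs
  q≤|cs| = subst (λ m → m + 1 ≤ length cs) (s*t∸a*[s+t∸a∸2]≡a+a+[s∸a]*[t∸a] 2≤a a≤s (≤-trans a≤s s≤t))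
             (atLeastColours⇒≤length {C = C} (isColouring C) colours)
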